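{- Let $n$ be a positive integer. There is a bijection between the set of descending plane partitions of order $n$ with no special parts and the set of integer partitions with largest part at most $n$ and with at most $i-1$ parts equal to $i$ for every $1\le i\le n$, such that the multiset of parts of each descending plane partition equals the multiset of parts of its image partition.
   Context: A descending plane partition (DPP) is an array of positive integers $\{a_{i,j}\}$ with $i\le j$, placed in shifted shape (row $i$ is indented by $i-1$ units, so row $i$ occupies consecutive positions $(i,i),(i,i+1),\dots$), such that entries weakly decrease along each row, strictly decrease down each column, and for each row the number of parts in that row is strictly less than the largest part in that row and is greater than or equal to the largest part in the next row. The empty array is a DPP. A DPP is of order $n$ if its largest part is at most $n$. A special part of a DPP is an entry $a_{i,j}$ with $a_{i,j}\le j-i$. -}

module Defs where

open import Data.Nat using (ℕ; zero; suc; _≤_; _<_; _⊔_; _∸_; _≟_)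
open import Data.List using (List; []; _∷_; length; foldr; filter; map; upTo; concat)
open import Data.List.Relation.Unary.All using (All)
open import Data.List.Relation.Unary.Linked using (Linked)
open import Data.Product using (Σ; _×_)
open import Data.Unit using (⊤)

-- A DPP is represented as the list of its rows (row 1 first); row i is the
-- list a_{i,i}, a_{i,i+1}, ... .  So the k-th entry (0-indexed) of row i is
-- a_{i,i+k}, and j - i = k.

largest : List ℕ → ℕ
largest = foldr _⊔_ 0

WeaklyDecreasing : List ℕ → Set
WeaklyDecreasing = Linked (λ a b → b ≤ a)

-- Column strictness between consecutive rows r (row i) and r' (row i+1):
-- a_{i+1,j} < a_{i,j} whenever both exist, i.e. r'[k] < r[k+1].
ColStrict : List ℕ → List ℕ → Set
ColStrict [] _ = ⊤
ColStrict (_ ∷ []) _ = ⊤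
ColStrict (_ ∷ _ ∷ _) [] = ⊤
ColStrict (_ ∷ x ∷ xs) (y ∷ ys) = (y < x) × ColStrict (x ∷ xs) ys

-- conditions on a single row: positive entries, weakly decreasing,
-- number of parts < largest part (forces the row to be nonempty)
RowOK : List ℕ → Set
RowOK r = All (λ x → 1 ≤ x) r × WeaklyDecreasing r × (length r < largest r)

NextOK : List ℕ → List (List ℕ) → Set
NextOK r [] = ⊤
NextOK r (r' ∷ _) = ColStrict r r' × (largest r' ≤ length r)

IsDPP : List (List ℕ) → Set
IsDPP [] = ⊤
IsDPP (r ∷ rs) = RowOK r × NextOK r rs × IsDPP rs

OfOrder : ℕ → List (List ℕ) → Set
OfOrder n d = All (All (λ x → x ≤ n)) d

-- a row r = a_{i,i}, a_{i,i+1}, ... has no special parts iff a_{i,i+k} > k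
-- for every k (special means a_{i,j} ≤ j - i).  Argument k = offset j - i.
NoSpecialFrom : ℕ → List ℕ → Set
NoSpecialFrom k [] = ⊤
NoSpecialFrom k (x ∷ xs) = (k < x) × NoSpecialFrom (suc k) xs

NoSpecialParts : List (List ℕ) → Set
NoSpecialParts d = All (NoSpecialFrom 0) d

DPPNoSpecial : ℕ → Set
DPPNoSpecial n = Σ (List (List ℕ)) (λ d → IsDPP d × OfOrder n d × NoSpecialParts d)

partsDPP : List (List ℕ) → List ℕ
partsDPP = concat

count : ℕ → List ℕ → ℕ
count i λ' = length (filter (_≟ i) λ')

RestrictedPartition : ℕ → Set
RestrictedPartition n =
  Σ (List ℕ) (λ p → WeaklyDecreasing p
                   × All (λ x → 1 ≤ x) p
                   × All (λ x → x ≤ n) p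
                   × All (λ i → count i p ≤ i ∸ 1) (map suc (upTo n)))

-- Descending plane partitions of order n without special parts correspond
-- bijectively to partitions with parts ≤ n in which each i occurs at most
-- i - 1 times; the bijection reads the rows one after another, so it keeps
-- the multiset of parts (literally: the image is the concatenation).
--
-- For a weakly decreasing row r, having no special parts says exactly that
-- every entry of r is at least |r|, while the DPP conditions force every entry
-- of the later rows to be at most |r|.  So a DPP without special parts is a
-- decomposition p = r₁ ++ r₂ ++ … of a partition p into "separated" blocks,
-- and such a decomposition is unique (injectivity).  Column strictness between
-- rows r = f ∷ xs and r' is equivalent to the counting condition
--   #(|r| in xs) + #(|r| in r') ≤ |xs|,
-- which turns the DPP conditions into the multiplicity bound #(i in p) ≤ i - 1
-- and back.  Conversely a restricted partition is cut into rows greedily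
-- (surjectivity).

module Submission where

open import Defs
open import Data.Nat using (ℕ; zero; suc; _+_; _≤_; _<_; _∸_; _≟_; _≤?_; _<?_; z≤n; s≤s; s≤s⁻¹)
open import Data.Nat.Properties
open import Data.List using (List; []; _∷_; length; filter; map; upTo; concat; _++_)
open import Data.List.Properties
  using (length-filter; filter-++; filter-none; filter-all; filter-accept; filter-reject;
         length-++; ++-assoc; ++-cancelˡ; ∷-injectiveˡ; ∷-injectiveʳ)
open import Data.List.Relation.Unary.All as All using (All; []; _∷_)
open import Data.List.Relation.Unary.All.Properties using (++⁺; ++⁻ˡ; ++⁻ʳ; concat⁺; concat⁻; map⁺)
open import Data.List.Relation.Unary.Linked as Linked using ([]; [-]; _∷_)
open import Data.List.Relation.Unary.Linked.Properties using (Linked⇒All)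
open import Data.List.Membership.Propositional.Properties using (∈-map⁺; ∈-upTo⁺)
open import Data.Product using (Σ; _×_; _,_; proj₁)
open import Data.Unit using (tt)
open import Data.Empty using (⊥; ⊥-elim)
open import Relation.Nullary using (¬_; yes; no)
open import Relation.Binary using (tri<; tri≈; tri>)
open import Relation.Binary.PropositionalEquality
open import Function.Bundles using (_⤖_; Bijection; mk⤖)
open import Data.List.Relation.Binary.Permutation.Propositional using (_↭_; ↭-refl)

open ≤-Reasoning

count-here : ∀ v xs → count v (v ∷ xs) ≡ suc (count v xs)
count-here v xs = cong length (filter-accept (_≟ v) {v} {xs} refl)

count-there : ∀ {v x} xs → ¬ x ≡ v → count v (x ∷ xs) ≡ count v xs
count-there {v} {x} xs x≢v = cong length (filter-reject (_≟ v) {x} {xs} x≢v)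

count≤length : ∀ v xs → count v xs ≤ length xs
count≤length v = length-filter (_≟ v)

count-++ : ∀ v xs ys → count v (xs ++ ys) ≡ count v xs + count v ys
count-++ v xs ys =
  trans (cong length (filter-++ (_≟ v) xs ys)) (length-++ (filter (_≟ v) xs))

count-++-left : ∀ v xs ys → count v xs ≤ count v (xs ++ ys)
count-++-left v xs ys = subst (count v xs ≤_) (sym (count-++ v xs ys)) (m≤m+n _ _)

count-++-right : ∀ v xs ys → count v ys ≤ count v (xs ++ ys)
count-++-right v xs ys = subst (count v ys ≤_) (sym (count-++ v xs ys)) (m≤n+m _ _)

count-below : ∀ {v xs} → All (_< v) xs → count v xs ≡ 0
count-below xs<v = cong length (filter-none (_≟ _) (All.map (λ x<v x≡v → <-irrefl x≡v x<v) xs<v))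

count-above : ∀ {v xs} → All (v <_) xs → count v xs ≡ 0
count-above v<xs = cong length (filter-none (_≟ _) (All.map (λ v<x x≡v → <-irrefl (sym x≡v) v<x) v<xs))

count-all : ∀ {v xs} → All (_≡ v) xs → count v xs ≡ length xs
count-all xs≡v = cong length (filter-all (_≟ _) xs≡v)

count-+-absent : ∀ v xs ys → count v ys ≡ 0 → count v xs + count v ys ≤ length xs
count-+-absent v xs ys absent = begin
  count v xs + count v ys ≡⟨ cong (count v xs +_) absent ⟩
  count v xs + 0          ≡⟨ +-identityʳ _ ⟩
  count v xs              ≤⟨ count≤length v xs ⟩
  length xs               ∎

bounded-by-head : ∀ {f xs} → WeaklyDecreasing (f ∷ xs) → All (_≤ f) xs
bounded-by-head wd = All.tail (Linked⇒All (λ b≤a c≤b → ≤-trans c≤b b≤a) ≤-refl wd)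

below-head : ∀ {v y ys} → WeaklyDecreasing (y ∷ ys) → y < v → All (_< v) (y ∷ ys)
below-head wd y<v = y<v ∷ All.map (λ z≤y → ≤-<-trans z≤y y<v) (bounded-by-head wd)

WD-++-left : ∀ xs {ys} → WeaklyDecreasing (xs ++ ys) → WeaklyDecreasing xs
WD-++-left [] _ = []
WD-++-left (x ∷ []) _ = [-]
WD-++-left (x ∷ y ∷ xs) (y≤x ∷ wd) = y≤x ∷ WD-++-left (y ∷ xs) wd

WD-++-right : ∀ xs {ys} → WeaklyDecreasing (xs ++ ys) → WeaklyDecreasing ys
WD-++-right [] wd = wd
WD-++-right (x ∷ xs) wd = WD-++-right xs (Linked.tail wd)

WD-++ : ∀ {b} xs {ys} → WeaklyDecreasing xs → WeaklyDecreasing ys →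
        All (b ≤_) xs → All (_≤ b) ys → WeaklyDecreasing (xs ++ ys)
WD-++ [] _ wy _ _ = wy
WD-++ (x ∷ []) {[]} _ _ _ _ = [-]
WD-++ (x ∷ []) {y ∷ ys} _ wy (b≤x ∷ []) (y≤b ∷ _) = ≤-trans y≤b b≤x ∷ wy
WD-++ (x ∷ x' ∷ xs) (x'≤x ∷ wx) wy (_ ∷ b≤xs) ys≤b = x'≤x ∷ WD-++ (x' ∷ xs) wx wy b≤xs ys≤b

largest-upper : ∀ r → All (_≤ largest r) r
largest-upper [] = []
largest-upper (x ∷ r) =
  m≤m⊔n x (largest r) ∷ All.map (λ z≤ → ≤-trans z≤ (m≤n⊔m x (largest r))) (largest-upper r)

largest-least : ∀ {b} r → All (_≤ b) r → largest r ≤ b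
largest-least [] [] = z≤n
largest-least (x ∷ r) (x≤b ∷ r≤b) = ⊔-lub x≤b (largest-least r r≤b)

largest-head : ∀ {f xs} → WeaklyDecreasing (f ∷ xs) → largest (f ∷ xs) ≡ f
largest-head {f} {xs} wd = m≥n⇒m⊔n≡m (largest-least xs (bounded-by-head wd))

rare-value-below-head : ∀ {v x xs} → All (v ≤_) (x ∷ xs) → WeaklyDecreasing (x ∷ xs) →
                        count v (x ∷ xs) < length (x ∷ xs) → v < x
rare-value-below-head {v} {x} v≤ wd rare with v ≟ x
... | no v≢x = ≤∧≢⇒< (All.head v≤) v≢x
... | yes refl = ⊥-elim (<-irrefl (count-all all-v) rare)
  where
  all-v : All (_≡ v) (v ∷ _)
  all-v = All.zipWith (λ (v≤z , z≤v) → ≤-antisym z≤v v≤z) (v≤ , ≤-refl ∷ bounded-by-head wd)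

noSpecial⇒long : ∀ k r → WeaklyDecreasing r → NoSpecialFrom k r → All (k + length r ≤_) r
noSpecial⇒long k [] _ _ = []
noSpecial⇒long k (x ∷ []) _ (k<x , _) = subst (_≤ x) (+-comm 1 k) k<x ∷ []
noSpecial⇒long k (x ∷ y ∷ ys) (y≤x ∷ wd) (_ , ns) =
  subst (λ m → All (m ≤_) (x ∷ y ∷ ys)) (sym (+-suc k (length (y ∷ ys)))) (≤-trans (All.head tail) y≤x ∷ tail)
  where
  tail : All (suc k + length (y ∷ ys) ≤_) (y ∷ ys)
  tail = noSpecial⇒long (suc k) (y ∷ ys) wd ns

long⇒noSpecial : ∀ k r → All (k + length r ≤_) r → NoSpecialFrom k r
long⇒noSpecial k [] _ = tt
long⇒noSpecial k (x ∷ xs) (b ∷ bs) =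
  <-≤-trans (m<m+n k (s≤s z≤n)) b ,
  long⇒noSpecial (suc k) xs (subst (λ m → All (m ≤_) xs) (+-suc k (length xs)) bs)

-- r is a possible first row in front of the entries q: all entries of r are
-- at least |r| and all entries of q at most |r|
Separated : List ℕ → List ℕ → Set
Separated r q = All (length r ≤_) r × All (_≤ length r) q

-- The occurrences of v form a
-- suffix of xs and a prefix of ys, and the rows are column strict iff these
-- two blocks do not meet in a column.

colStrict⇒count : ∀ {v} a xs ys → ColStrict (a ∷ xs) ys → WeaklyDecreasing ys →
                  All (_≤ v) ys → length ys ≤ length xs → count v xs + count v ys ≤ length xs
colStrict⇒count {v} a xs [] _ _ _ _ = count-+-absent v xs [] refl
colStrict⇒count a [] (y ∷ ys) _ _ _ ()
colStrict⇒count {v} a (x ∷ xs) (y ∷ ys) (y<x , cs) wd (y≤v ∷ ys≤v) (s≤s len) with y ≟ v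
... | yes refl = begin
  count y (x ∷ xs) + count y (y ∷ ys) ≡⟨ cong₂ _+_ (count-there xs (λ x≡y → <-irrefl (sym x≡y) y<x)) (count-here y ys) ⟩
  count y xs + suc (count y ys)       ≡⟨ +-suc _ _ ⟩
  suc (count y xs + count y ys)       ≤⟨ s≤s (colStrict⇒count x xs ys cs (Linked.tail wd) ys≤v len) ⟩
  suc (length xs)                     ∎
... | no y≢v = count-+-absent v (x ∷ xs) (y ∷ ys) (count-below (below-head wd (≤∧≢⇒< y≤v y≢v)))

count⇒colStrict : ∀ {v} a xs ys → All (v ≤_) xs → WeaklyDecreasing xs → WeaklyDecreasing ys →
                  All (_≤ v) ys → count v xs + count v ys ≤ length xs → ColStrict (a ∷ xs) ys
count⇒colStrict a [] ys _ _ _ _ _ = tt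
count⇒colStrict a (x ∷ xs) [] _ _ _ _ _ = tt
count⇒colStrict {v} a (x ∷ xs) (y ∷ ys) v≤xs wdx wdy (y≤v ∷ ys≤v) counts with y ≟ v
... | yes refl =
  y<x , count⇒colStrict x xs ys (All.tail v≤xs) (Linked.tail wdx) (Linked.tail wdy) ys≤v tail-counts
  where
  counts' : suc (count y (x ∷ xs) + count y ys) ≤ suc (length xs)
  counts' = begin
    suc (count y (x ∷ xs) + count y ys) ≡⟨ +-suc _ _ ⟨
    count y (x ∷ xs) + suc (count y ys) ≡⟨ cong (count y (x ∷ xs) +_) (count-here y ys) ⟨
    count y (x ∷ xs) + count y (y ∷ ys) ≤⟨ counts ⟩
    suc (length xs)                     ∎
  -- y occurs in the second row, so it occurs at most |xs| times in x ∷ xs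
  -- and therefore is not x
  y<x : y < x
  y<x = rare-value-below-head v≤xs wdx (≤-trans (s≤s (m≤m+n _ _)) counts')
  tail-counts : count y xs + count y ys ≤ length xs
  tail-counts = s≤s⁻¹ (≤-trans (s≤s (+-monoˡ-≤ _ (count-++-right y (x ∷ []) xs))) counts')
... | no y≢v =
  <-≤-trans y<v (All.head v≤xs) ,
  count⇒colStrict x xs ys (All.tail v≤xs) (Linked.tail wdx) (Linked.tail wdy) ys≤v tail-counts
  where
  y<v : y < v
  y<v = ≤∧≢⇒< y≤v y≢v
  tail-counts : count v xs + count v ys ≤ length xs
  tail-counts = count-+-absent v xs ys (count-below (All.tail (below-head wdy y<v)))

laterRows≤ : ∀ {r} rs → NextOK r rs → IsDPP rs → All (_≤ length r) (concat rs)
laterRows≤ [] _ _ = []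
laterRows≤ (r' ∷ rs) (_ , r'≤r) ((_ , _ , |r'|<r') , next , isDPP) =
  ++⁺ (All.map (λ z≤ → ≤-trans z≤ r'≤r) (largest-upper r'))
      (All.map (λ z≤ → ≤-trans z≤ (≤-trans (<⇒≤ |r'|<r') r'≤r)) (laterRows≤ rs next isDPP))

nextOK⇒count : ∀ {f} xs rs → NextOK (f ∷ xs) rs → IsDPP rs →
               count (suc (length xs)) xs + count (suc (length xs)) (concat rs) ≤ length xs
nextOK⇒count xs [] _ _ = count-+-absent _ xs [] refl
nextOK⇒count {f} xs (r' ∷ rs) (cs , r'≤L) ((_ , wd' , |r'|<r') , next , isDPP) = begin
  count L xs + count L (r' ++ concat rs)         ≡⟨ cong (count L xs +_) (count-++ L r' (concat rs)) ⟩
  count L xs + (count L r' + count L (concat rs)) ≡⟨ cong (λ m → count L xs + (count L r' + m)) (count-below rest<L) ⟩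
  count L xs + (count L r' + 0)                  ≡⟨ cong (count L xs +_) (+-identityʳ _) ⟩
  count L xs + count L r'                        ≤⟨ colStrict⇒count f xs r' cs wd' r'-bounds (s≤s⁻¹ |r'|<L) ⟩
  length xs                                      ∎
  where
  L = suc (length xs)
  |r'|<L : length r' < L
  |r'|<L = <-≤-trans |r'|<r' r'≤L
  r'-bounds : All (_≤ L) r'
  r'-bounds = All.map (λ z≤ → ≤-trans z≤ r'≤L) (largest-upper r')
  rest<L : All (_< L) (concat rs)
  rest<L = All.map (λ z≤ → ≤-<-trans z≤ |r'|<L) (laterRows≤ rs next isDPP)

count⇒nextOK : ∀ {f} xs rs → IsDPP rs → All (_≤ suc (length xs)) (concat rs) →
               All (suc (length xs) ≤_) xs → WeaklyDecreasing xs →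
               count (suc (length xs)) xs + count (suc (length xs)) (concat rs) ≤ length xs →
               NextOK (f ∷ xs) rs
count⇒nextOK xs [] _ _ _ _ _ = tt
count⇒nextOK {f} xs (r' ∷ rs) ((_ , wd' , _) , _) rs≤L L≤xs wdx counts =
  count⇒colStrict f xs r' L≤xs wdx wd' r'≤L
    (≤-trans (+-monoʳ-≤ (count L xs) (count-++-left L r' (concat rs))) counts) ,
  largest-least r' r'≤L
  where
  L = suc (length xs)
  r'≤L : All (_≤ L) r'
  r'≤L = ++⁻ˡ r' rs≤L

rows-separated : ∀ {r} rs → RowOK r → NextOK r rs → IsDPP rs → NoSpecialFrom 0 r → Separated r (concat rs)
rows-separated {r} rs (_ , wd , _) next isDPP ns = noSpecial⇒long 0 r wd ns , laterRows≤ rs next isDPP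

parts-decreasing : ∀ d → IsDPP d → NoSpecialParts d → WeaklyDecreasing (concat d)
parts-decreasing [] _ _ = []
parts-decreasing (r ∷ rs) (rowOK@(_ , wd , _) , next , isDPP) (ns ∷ nss)
  with rows-separated rs rowOK next isDPP ns
... | r≥L , rs≤L = WD-++ r wd (parts-decreasing rs isDPP nss) r≥L rs≤L

parts-positive : ∀ d → IsDPP d → All (All (1 ≤_)) d
parts-positive [] _ = []
parts-positive (r ∷ rs) ((pos , _) , _ , isDPP) = pos ∷ parts-positive rs isDPP

parts-count : ∀ d → IsDPP d → NoSpecialParts d → ∀ v → count (suc v) (concat d) ≤ v
parts-count [] _ _ v = z≤n
parts-count ([] ∷ rs) ((_ , _ , ()) , _) _ v
parts-count ((f ∷ xs) ∷ rs) (rowOK@(_ , wd , |r|<f) , next , isDPP) (ns ∷ nss) v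
  with rows-separated rs rowOK next isDPP ns | <-cmp (suc v) (suc (length xs))
... | r≥L , _ | tri< w<L _ _ = begin
  count (suc v) ((f ∷ xs) ++ concat rs)          ≡⟨ count-++ (suc v) (f ∷ xs) (concat rs) ⟩
  count (suc v) (f ∷ xs) + count (suc v) (concat rs) ≡⟨ cong (_+ count (suc v) (concat rs)) (count-above (All.map (<-≤-trans w<L) r≥L)) ⟩
  count (suc v) (concat rs)                      ≤⟨ parts-count rs isDPP nss v ⟩
  v                                              ∎
... | _ , rs≤L | tri> _ _ L<w = begin
  count (suc v) ((f ∷ xs) ++ concat rs)          ≡⟨ count-++ (suc v) (f ∷ xs) (concat rs) ⟩
  count (suc v) (f ∷ xs) + count (suc v) (concat rs) ≡⟨ cong (count (suc v) (f ∷ xs) +_) (count-below (All.map (λ z≤ → ≤-<-trans z≤ L<w) rs≤L)) ⟩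
  count (suc v) (f ∷ xs) + 0                     ≡⟨ +-identityʳ _ ⟩
  count (suc v) (f ∷ xs)                         ≤⟨ count≤length (suc v) (f ∷ xs) ⟩
  suc (length xs)                                ≤⟨ s≤s⁻¹ L<w ⟩
  v                                              ∎
... | _ | tri≈ _ refl _ = begin
  count L ((f ∷ xs) ++ concat rs)     ≡⟨ count-++ L (f ∷ xs) (concat rs) ⟩
  count L (f ∷ xs) + count L (concat rs) ≡⟨ cong (_+ count L (concat rs)) (count-there xs f≢L) ⟩
  count L xs + count L (concat rs)    ≤⟨ nextOK⇒count xs rs next isDPP ⟩
  length xs                           ∎
  where
  L = suc (length xs)
  -- the head f is the largest part, which exceeds the row length L
  f≢L : ¬ f ≡ L
  f≢L f≡L = <-irrefl (sym f≡L) (subst (L <_) (largest-head wd) |r|<f)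

range-counts⇒counts : ∀ n p → All (_≤ n) p → All (λ i → count i p ≤ i ∸ 1) (map suc (upTo n)) →
                      ∀ v → count (suc v) p ≤ v
range-counts⇒counts n p p≤n counts v with v <? n
... | yes v<n = All.lookup counts (∈-map⁺ suc (∈-upTo⁺ v<n))
... | no v≮n = subst (_≤ v) (sym (count-below (All.map (λ z≤n → ≤-<-trans z≤n (s≤s (≮⇒≥ v≮n))) p≤n))) z≤n

counts⇒range-counts : ∀ p → (∀ v → count (suc v) p ≤ v) → ∀ l → All (λ i → count i p ≤ i ∸ 1) (map suc l)
counts⇒range-counts p counts l = map⁺ (All.tabulate (λ {v} _ → counts v))

toPartition : ∀ n → DPPNoSpecial n → RestrictedPartition n
toPartition n (d , isDPP , order , noSpecial) =
  concat d , parts-decreasing d isDPP noSpecial , concat⁺ (parts-positive d isDPP) , concat⁺ order ,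
  counts⇒range-counts (concat d) (parts-count d isDPP noSpecial) (upTo n)

-- if r₁ ++ q₁ ≡ r₂ ++ q₂ with r₁ shorter, the head of q₁ lies in r₂; so the
-- entries of r₂ and of q₁ cannot satisfy disjoint properties P and Q
shorter-prefix : ∀ {P Q : ℕ → Set} r₁ q₁ r₂ q₂ → (∀ {z} → P z → Q z → ⊥) →
                 All P r₂ → All Q q₁ → length r₁ < length r₂ → r₁ ++ q₁ ≡ r₂ ++ q₂ → ⊥
shorter-prefix [] [] (y ∷ r₂) q₂ disjoint _ _ _ ()
shorter-prefix [] (z ∷ q₁) (y ∷ r₂) q₂ disjoint (Py ∷ _) (Qz ∷ _) _ eq =
  disjoint Py (subst _ (∷-injectiveˡ eq) Qz)
shorter-prefix (x ∷ r₁) q₁ (y ∷ r₂) q₂ disjoint (_ ∷ Pr₂) Qq₁ (s≤s lt) eq =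
  shorter-prefix r₁ q₁ r₂ q₂ disjoint Pr₂ Qq₁ lt (∷-injectiveʳ eq)

equal-length-prefix : ∀ (r₁ q₁ r₂ q₂ : List ℕ) → length r₁ ≡ length r₂ → r₁ ++ q₁ ≡ r₂ ++ q₂ → r₁ ≡ r₂
equal-length-prefix [] _ [] _ _ _ = refl
equal-length-prefix (x ∷ r₁) q₁ (y ∷ r₂) q₂ len eq =
  cong₂ _∷_ (∷-injectiveˡ eq) (equal-length-prefix r₁ q₁ r₂ q₂ (suc-injective len) (∷-injectiveʳ eq))

separated-unique : ∀ r₁ q₁ r₂ q₂ → Separated r₁ q₁ → Separated r₂ q₂ → r₁ ++ q₁ ≡ r₂ ++ q₂ → r₁ ≡ r₂
separated-unique r₁ q₁ r₂ q₂ (r₁≥ , q₁≤) (r₂≥ , q₂≤) eq with <-cmp (length r₁) (length r₂)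
... | tri< lt _ _ = ⊥-elim (shorter-prefix r₁ q₁ r₂ q₂ (λ b≤z z≤a → <⇒≱ lt (≤-trans b≤z z≤a)) r₂≥ q₁≤ lt eq)
... | tri≈ _ len _ = equal-length-prefix r₁ q₁ r₂ q₂ len eq
... | tri> _ _ gt = ⊥-elim (shorter-prefix r₂ q₂ r₁ q₁ (λ b≤z z≤a → <⇒≱ gt (≤-trans b≤z z≤a)) r₁≥ q₂≤ gt (sym eq))

concat-injective : ∀ d₁ d₂ → IsDPP d₁ → NoSpecialParts d₁ → IsDPP d₂ → NoSpecialParts d₂ →
                   concat d₁ ≡ concat d₂ → d₁ ≡ d₂
concat-injective [] [] _ _ _ _ _ = refl
concat-injective [] ([] ∷ _) _ _ ((_ , _ , ()) , _) _ _
concat-injective [] ((_ ∷ _) ∷ _) _ _ _ _ ()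
concat-injective ([] ∷ _) _ ((_ , _ , ()) , _) _ _ _ _
concat-injective ((_ ∷ _) ∷ _) [] _ _ _ _ ()
concat-injective (r₁ ∷ rs₁) (r₂ ∷ rs₂) (row₁ , next₁ , dpp₁) (ns₁ ∷ nss₁) (row₂ , next₂ , dpp₂) (ns₂ ∷ nss₂) eq =
  cong₂ _∷_ r₁≡r₂ (concat-injective rs₁ rs₂ dpp₁ nss₁ dpp₂ nss₂ (++-cancelˡ r₁ (concat rs₁) (concat rs₂) eq'))
  where
  r₁≡r₂ : r₁ ≡ r₂
  r₁≡r₂ = separated-unique r₁ (concat rs₁) r₂ (concat rs₂)
            (rows-separated rs₁ row₁ next₁ dpp₁ ns₁) (rows-separated rs₂ row₂ next₂ dpp₂ ns₂) eq
  eq' : r₁ ++ concat rs₁ ≡ r₁ ++ concat rs₂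
  eq' = subst (λ r → r₁ ++ concat rs₁ ≡ r ++ concat rs₂) (sym r₁≡r₂) eq

-- Greedy first row: keep taking entries while they exceed the current row
-- length.  Invariant: the row f ∷ xs is separated from its own length, and
-- all its entries are ≥ h ≥ all remaining entries s.
grow-row : ∀ f xs s {h} → WeaklyDecreasing s → All (h ≤_) (f ∷ xs) → All (_≤ h) s →
           All (length (f ∷ xs) ≤_) (f ∷ xs) →
           Σ (List ℕ) λ xs' → Σ (List ℕ) λ q → xs ++ s ≡ xs' ++ q × Separated (f ∷ xs') q
grow-row f xs [] _ _ _ r≥L = xs , [] , refl , r≥L , []
grow-row f xs (y ∷ s) wd r≥h s≤h r≥L with y ≤? length (f ∷ xs)
... | yes y≤L = xs , y ∷ s , refl , r≥L , y≤L ∷ All.map (λ z≤y → ≤-trans z≤y y≤L) (bounded-by-head wd)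
... | no y≰L with grow-row f (xs ++ y ∷ []) s (Linked.tail wd) r'≥y (bounded-by-head wd) r'≥L'
  where
  |xs'|≡ : length (xs ++ y ∷ []) ≡ suc (length xs)
  |xs'|≡ = trans (length-++ xs) (+-comm (length xs) 1)
  r'≥y : All (y ≤_) (f ∷ xs ++ y ∷ [])
  r'≥y = ++⁺ (All.map (≤-trans (All.head s≤h)) r≥h) (≤-refl ∷ [])
  r'≥L' : All (length (f ∷ xs ++ y ∷ []) ≤_) (f ∷ xs ++ y ∷ [])
  r'≥L' = All.map (λ {z} y≤z → subst (_≤ z) (sym (cong suc |xs'|≡)) (≤-trans (≰⇒> y≰L) y≤z)) r'≥y
... | xs' , q , eq , sep = xs' , q , trans (sym (++-assoc xs (y ∷ []) s)) eq , sep

firstRow : ∀ x p → WeaklyDecreasing (x ∷ p) → 1 ≤ x →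
           Σ (List ℕ) λ xs → Σ (List ℕ) λ q → p ≡ xs ++ q × Separated (x ∷ xs) q
firstRow x p wd 1≤x = grow-row x [] p (Linked.tail wd) (≤-refl ∷ []) (bounded-by-head wd) (1≤x ∷ [])

Preimage : List ℕ → Set
Preimage p = Σ (List (List ℕ)) λ d → IsDPP d × NoSpecialParts d × concat d ≡ p

cut-into-rows : ∀ fuel p → length p ≤ fuel → WeaklyDecreasing p → All (1 ≤_) p →
                (∀ v → count (suc v) p ≤ v) → Preimage p
cut-into-rows _ [] _ _ _ _ = [] , tt , [] , refl
cut-into-rows zero (x ∷ p) () _ _ _
cut-into-rows (suc fuel) (x ∷ p) (s≤s len) wd pos counts with firstRow x p wd (All.head pos)
... | xs , q , refl , r≥L , q≤L
  with cut-into-rows fuel q q-len (WD-++-right (x ∷ xs) wd) (++⁻ʳ (x ∷ xs) pos)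
         (λ v → ≤-trans (count-++-right (suc v) (x ∷ xs) q) (counts v))
  where
  q-len : length q ≤ fuel
  q-len = ≤-trans (subst (length q ≤_) (sym (length-++ xs)) (m≤n+m _ _)) len
... | d , isDPP , noSpecial , refl =
  (x ∷ xs) ∷ d , (rowOK , nextOK , isDPP) , long⇒noSpecial 0 (x ∷ xs) r≥L ∷ noSpecial , refl
  where
  L = suc (length xs)
  wdr : WeaklyDecreasing (x ∷ xs)
  wdr = WD-++-left (x ∷ xs) wd
  boundary : count L (x ∷ xs) + count L (concat d) ≤ length xs
  boundary = subst (_≤ length xs) (count-++ L (x ∷ xs) (concat d)) (counts (length xs))
  -- L occurs fewer than L times in the row, so the head exceeds the length
  L<x : L < x
  L<x = rare-value-below-head r≥L wdr (s≤s (≤-trans (m≤m+n _ _) boundary))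
  rowOK : RowOK (x ∷ xs)
  rowOK = ++⁻ˡ (x ∷ xs) pos , wdr , subst (L <_) (sym (largest-head wdr)) L<x
  nextOK : NextOK (x ∷ xs) d
  nextOK = count⇒nextOK xs d isDPP q≤L (All.tail r≥L) (Linked.tail wdr)
             (subst (λ m → m + count L (concat d) ≤ length xs) (count-there xs (λ x≡L → <-irrefl (sym x≡L) L<x)) boundary)

-- The DPP and partition conditions are proof irrelevant, so elements of both
-- sets are determined by their underlying lists.

colStrict-irrelevant : ∀ r r' (a b : ColStrict r r') → a ≡ b
colStrict-irrelevant [] _ _ _ = refl
colStrict-irrelevant (_ ∷ []) _ _ _ = refl
colStrict-irrelevant (_ ∷ _ ∷ _) [] _ _ = refl
colStrict-irrelevant (_ ∷ x ∷ xs) (y ∷ ys) (p , a) (q , b) =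
  cong₂ _,_ (≤-irrelevant p q) (colStrict-irrelevant (x ∷ xs) ys a b)

WD-irrelevant : ∀ {r} (a b : WeaklyDecreasing r) → a ≡ b
WD-irrelevant = Linked.irrelevant ≤-irrelevant

isDPP-irrelevant : ∀ d (a b : IsDPP d) → a ≡ b
isDPP-irrelevant [] _ _ = refl
isDPP-irrelevant (r ∷ rs) ((p₁ , w₁ , l₁) , n₁ , d₁) ((p₂ , w₂ , l₂) , n₂ , d₂) =
  cong₂ _,_ (cong₂ _,_ (All.irrelevant ≤-irrelevant p₁ p₂) (cong₂ _,_ (WD-irrelevant w₁ w₂) (≤-irrelevant l₁ l₂)))
            (cong₂ _,_ (next-irrelevant rs n₁ n₂) (isDPP-irrelevant rs d₁ d₂))
  where
  next-irrelevant : ∀ rs (a b : NextOK r rs) → a ≡ b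
  next-irrelevant [] _ _ = refl
  next-irrelevant (r' ∷ _) (c₁ , b₁) (c₂ , b₂) = cong₂ _,_ (colStrict-irrelevant r r' c₁ c₂) (≤-irrelevant b₁ b₂)

noSpecial-irrelevant : ∀ k r (a b : NoSpecialFrom k r) → a ≡ b
noSpecial-irrelevant k [] _ _ = refl
noSpecial-irrelevant k (x ∷ r) (p , a) (q , b) = cong₂ _,_ (≤-irrelevant p q) (noSpecial-irrelevant (suc k) r a b)

dpp-≡ : ∀ {n} {x y : DPPNoSpecial n} → proj₁ x ≡ proj₁ y → x ≡ y
dpp-≡ {x = d , i₁ , o₁ , s₁} {.d , i₂ , o₂ , s₂} refl =
  cong (d ,_) (cong₂ _,_ (isDPP-irrelevant d i₁ i₂)
    (cong₂ _,_ (All.irrelevant (All.irrelevant ≤-irrelevant) o₁ o₂) (All.irrelevant (noSpecial-irrelevant 0 _) s₁ s₂)))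

partition-≡ : ∀ {n} {x y : RestrictedPartition n} → proj₁ x ≡ proj₁ y → x ≡ y
partition-≡ {x = p , w₁ , a₁ , b₁ , c₁} {.p , w₂ , a₂ , b₂ , c₂} refl =
  cong (p ,_) (cong₂ _,_ (WD-irrelevant w₁ w₂) (cong₂ _,_ (All.irrelevant ≤-irrelevant a₁ a₂)
    (cong₂ _,_ (All.irrelevant ≤-irrelevant b₁ b₂) (All.irrelevant ≤-irrelevant c₁ c₂))))

toPartition-bijection : ∀ n → DPPNoSpecial n ⤖ RestrictedPartition n
toPartition-bijection n = mk⤖ {to = toPartition n} (injective , surjective)
  where
  injective : ∀ {x y} → toPartition n x ≡ toPartition n y → x ≡ y
  injective {d₁ , i₁ , _ , s₁} {d₂ , i₂ , _ , s₂} eq = dpp-≡ (concat-injective d₁ d₂ i₁ s₁ i₂ s₂ (cong proj₁ eq))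
  surjective : ∀ y → Σ (DPPNoSpecial n) λ x → ∀ {z} → z ≡ x → toPartition n z ≡ y
  surjective (p , wd , pos , p≤n , counts)
    with cut-into-rows (length p) p ≤-refl wd pos (range-counts⇒counts n p p≤n counts)
  ... | d , isDPP , noSpecial , refl =
    (d , isDPP , concat⁻ p≤n , noSpecial) , λ { refl → partition-≡ refl }

lemma2p1 : (n : ℕ) → 1 ≤ n →
    Σ (DPPNoSpecial n ⤖ RestrictedPartition n)
    (λ b → (d : DPPNoSpecial n) → partsDPP (proj₁ d) ↭ proj₁ (Bijection.to b d))
lemma2p1 n _ = toPartition-bijection n , λ _ → ↭-refl
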